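{- Let $d\geq 3$ and $n=2^d$. Let $A_1$ be a set of vertices of $FDSC_n$ and let $A_2$ be a set of pairs $\{y,z\}$ such that $(y,z)$ is an edge of $FDSC_n$, with $|A_1|+|A_2|\leq d$. Then the graph $FDSC_n-(A_1\cup A_2)$, obtained by deleting all vertices in $A_1$ and all endpoints of the edges in $A_2$, is connected.
   Context: For $n=2^d$ ($d\ge 1$), the folded divide-and-swap cube $FDSC_n$ is the graph with vertex set $\{0,1\}^n$ (binary strings $u=s_1s_2\ldots s_n$). For $1\le k\le d$ write $u=m_1m_2m_3$ with $m_1=s_1\ldots s_{n/2^k}$, $m_2=s_{n/2^k+1}\ldots s_{n/2^{k-1}}$, $m_3=s_{n/2^{k-1}+1}\ldots s_n$ ($m_3$ empty when $k=1$). A vertex $v$ is adjacent to $u$ iff one of the following holds: (1) $v=\bar s_1s_2\ldots s_n$; (2) for some $1\le k\le d$, $v=\bar m_1\bar m_2m_3$ if $m_1=m_2$, and $v=m_2m_1m_3$ otherwise; (3) $v=s_1\bar s_2s_3\ldots s_n$. Here a bar denotes bitwise complement. -}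

module Defs where

open import Data.Bool using (Bool; not; if_then_else_)
open import Data.Bool.Properties using () renaming (_≟_ to _≟ᵇ_)
open import Data.Nat using (ℕ; zero; suc; _+_; _*_; _∸_; _^_; _≤_)
open import Data.List using (List; []; _∷_; take; drop; map; _++_)
open import Data.List.Properties using (≡-dec)
open import Data.List.Membership.Propositional using (_∈_)
open import Data.List.Relation.Unary.Any using (Any)
open import Data.Vec using (Vec; toList)
open import Data.Product using (Σ; ∃; _×_; _,_; proj₁; proj₂)
open import Data.Sum using (_⊎_)
open import Relation.Nullary using (¬_; does)
open import Relation.Binary.PropositionalEquality using (_≡_)
open import Relation.Binary.Construct.Closure.ReflexiveTransitive using (Star)

Vertex : ℕ → Set
Vertex d = Vec Bool (2 ^ d)

flipFirst : List Bool → List Bool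
flipFirst []       = []
flipFirst (s ∷ ss) = not s ∷ ss

flipSecond : List Bool → List Bool
flipSecond []           = []
flipSecond (s ∷ [])     = s ∷ []
flipSecond (s ∷ t ∷ ss) = s ∷ not t ∷ ss

-- Operation (2) at level k (1 ≤ k ≤ d): blocks m1, m2 of length n/2^k = 2^(d-k),
-- m3 the rest. If m1 = m2 complement both, otherwise swap them.
divSwap : ℕ → ℕ → List Bool → List Bool
divSwap d k u =
  let b  = 2 ^ (d ∸ k)
      m1 = take b u
      m2 = take b (drop b u)
      m3 = drop (b + b) u
  in if does (≡-dec _≟ᵇ_ m1 m2)
       then map not m1 ++ map not m2 ++ m3
       else m2 ++ m1 ++ m3

Adj : (d : ℕ) → Vertex d → Vertex d → Set
Adj d u v =
  (toList v ≡ flipFirst (toList u))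
  ⊎ (Σ ℕ λ k → (1 ≤ k) × (k ≤ d) × (toList v ≡ divSwap d k (toList u)))
  ⊎ (toList v ≡ flipSecond (toList u))

Edge : ℕ → Set
Edge d = Σ (Vertex d × Vertex d) λ p → Adj d (proj₁ p) (proj₂ p)

Removed : (d : ℕ) → List (Vertex d) → List (Edge d) → Vertex d → Set
Removed d A1 A2 w =
  (w ∈ A1) ⊎ Any (λ e → (w ≡ proj₁ (proj₁ e)) ⊎ (w ≡ proj₂ (proj₁ e))) A2

AdjAlive : (d : ℕ) → List (Vertex d) → List (Edge d) → Vertex d → Vertex d → Set
AdjAlive d A1 A2 u v = Adj d u v × ¬ Removed d A1 A2 u × ¬ Removed d A1 A2 v

ConnectedAfterRemoval : (d : ℕ) → List (Vertex d) → List (Edge d) → Set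
ConnectedAfterRemoval d A1 A2 =
  (u v : Vertex d) → ¬ Removed d A1 A2 u → ¬ Removed d A1 A2 v →
  Star (AdjAlive d A1 A2) u v

-- FDSC on 2^(e+2) bits is a "swap product" of copies of FDSC on 2^(e+1) bits: a vertex
-- is a pair (L , R) of halves, the moves of level ≥ 2 and the two bit flips act on L inside the copy
-- indexed by R, and the level-1 move joins (L , R) to (R , L), or to (comp L , comp L) when L = R.
-- We show by induction on d ≥ 3 that FDSC on 2^d bits survives any d faults. In the next dimension,
-- every surviving vertex can walk (both ways) to a surviving vertex whose copy is still connected:
-- its own copy if that copy carries at most d faults, and otherwise, since then all d + 1 faults
-- meet its copy, the copy across its level-1 edge, which contains at most one faulty vertex. Two such
-- copies are joined through a copy that no fault touches; one exists because there are 2^(2^d) copies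
-- and the faults mention at most 4(d + 1) of them. For d = 3 the copies are FDSC on 4 bits, which
-- tolerates only one fault; the missing two-fault properties are established by a certified
-- exhaustive search over all configurations.

module Submission where

open import Defs
open import Data.Bool using (Bool; true; false; not; if_then_else_; _∧_; T)
open import Data.Bool.ListAction using (all)
open import Data.Bool.Properties using (not-involutive; T-≡) renaming (_≟_ to _≟ᵇ_)
open import Data.Empty using (⊥; ⊥-elim)
open import Data.List using (List; []; _∷_; length; map; _++_; take; drop; concatMap; filter)
open import Data.List.Membership.Propositional using (_∈_; _∉_; find)
open import Data.List.Membership.Propositional.Properties using (∈-map⁺; ∈-++⁺ˡ; ∈-++⁺ʳ; ∈-concatMap⁺; ∈-filter⁺)
open import Data.List.Membership.DecPropositional using () renaming (_∈?_ to ∈-dec)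
open import Data.List.Properties using (length-++; length-map; ++-assoc; ++-identityʳ; take-all; drop-all; length-drop; drop-drop; ∷-injectiveˡ; ∷-injectiveʳ) renaming (≡-dec to List-≡-dec)
open import Data.List.Relation.Unary.All as All using (All; []; _∷_; all?)
open import Data.List.Relation.Unary.All.Properties using (all-filter; all⁺; ++⁺) renaming (map⁺ to All-map⁺)
open import Data.List.Relation.Unary.Any as Any using (Any; here; there; any?)
open import Data.List.Relation.Unary.Any.Properties using (++⁺ˡ; ++⁺ʳ; ++⁻; map⁺; map⁻)
open import Data.Nat using (ℕ; zero; suc; pred; _+_; _*_; _∸_; _^_; _≤_; _<_; z≤n; s≤s; s≤s⁻¹; _≤?_; _<?_)
open import Data.Nat.Properties using (≤-trans; ≤-refl; ≤-<-trans; m≤n⇒m≤1+n; ≰⇒>; ≮⇒≥; 1+n≰n; m≤m+n; m∸n≤m; m+n≤o⇒m≤o∸n; +-suc; +-comm; +-identityʳ; +-mono-≤; +-monoˡ-≤; +-monoˡ-<; +-cancelˡ-≤; +-cancelˡ-<; +-cancelʳ-≡; *-suc; *-assoc; *-monoʳ-≤; ^-monoʳ-≤; m^n>0; module ≤-Reasoning)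
open import Data.Product using (Σ; ∃-syntax; _×_; _,_; proj₁; proj₂)
open import Data.Product.Properties using () renaming (≡-dec to ×-≡-dec)
open import Data.Sum using (_⊎_; inj₁; inj₂; reduce)
open import Data.Vec as Vec using (Vec; []; _∷_; toList)
open import Data.Vec.Properties using (toList-++; toList-cast; toList-map; take++drop≡id; length-toList; toList-injective; cast-is-id; cast-trans; ++-injective) renaming (≡-dec to Vec-≡-dec)
open import Function using (_∘_)
open import Function.Bundles using (module Equivalence)
open import Relation.Binary.Construct.Closure.ReflexiveTransitive using (Star; ε; _◅_; _◅◅_; gmap) renaming (reverse to reverseStar)
open import Relation.Binary.Definitions using (DecidableEquality)
open import Relation.Binary.PropositionalEquality using (_≡_; _≢_; refl; sym; trans; cong; cong₂; subst; subst₂)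
open import Relation.Nullary using (¬_; Dec; yes; no; does; ¬?)
open import Relation.Nullary.Decidable using (True; isYes; toWitness; dec-true; dec-false; _⊎-dec_; _×-dec_)
open import Relation.Unary using (Decidable)

-- Faults in an arbitrary graph

module _ {V : Set} where

  -- A fault (y , z) deletes both endpoints; a deleted vertex y is the fault (y , y).
  IsFault : (V → V → Set) → V × V → Set
  IsFault E p = (proj₁ p ≡ proj₂ p) ⊎ E (proj₁ p) (proj₂ p)

  NonDiagonal : V × V → Set
  NonDiagonal p = proj₁ p ≢ proj₂ p

  Hits : V → V × V → Set
  Hits w p = (w ≡ proj₁ p) ⊎ (w ≡ proj₂ p)

  Faulty : List (V × V) → V → Set
  Faulty F w = Any (Hits w) F

  LiveEdge : (V → V → Set) → List (V × V) → V → V → Set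
  LiveEdge E F u v = E u v × ¬ Faulty F u × ¬ Faulty F v

  Path : (V → V → Set) → List (V × V) → V → V → Set
  Path E F = Star (LiveEdge E F)

  faulty? : DecidableEquality V → ∀ F w → Dec (Faulty F w)
  faulty? _≟_ F w = any? (λ p → (w ≟ proj₁ p) ⊎-dec (w ≟ proj₂ p)) F

  ConnectedAfter : (V → V → Set) → List (V × V) → Set
  ConnectedAfter E F = ∀ {u v} → ¬ Faulty F u → ¬ Faulty F v → Path E F u v

  Path-antitone : ∀ {E F F′} → (∀ {w} → Faulty F′ w → Faulty F w) →
    ∀ {u v} → Path E F u v → Path E F′ u v
  Path-antitone F′⊆F = gmap (λ w → w) λ (e , u-live , v-live) →
    e , (λ f → u-live (F′⊆F f)) , (λ f → v-live (F′⊆F f))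

FaultTolerant : {V : Set} → (V → V → Set) → ℕ → Set
FaultTolerant {V} E g = (F : List (V × V)) → All (IsFault E) F → length F ≤ g → ConnectedAfter E F

module _ {V V′ : Set} (E : V → V → Set) (E′ : V′ → V′ → Set)
  (to : V → V′) (from : V′ → V)
  (from∘to : ∀ v → from (to v) ≡ v) (to∘from : ∀ v → to (from v) ≡ v)
  (to-adj : ∀ {u v} → E u v → E′ (to u) (to v))
  (from-adj : ∀ {u v} → E′ u v → E (from u) (from v)) where

  private
    toFaults : List (V × V) → List (V′ × V′)
    toFaults = map (λ p → to (proj₁ p) , to (proj₂ p))

    toFaults-isFault : ∀ {F} → All (IsFault E) F → All (IsFault E′) (toFaults F)
    toFaults-isFault [] = []
    toFaults-isFault (inj₁ y≡z ∷ ok) = inj₁ (cong to y≡z) ∷ toFaults-isFault ok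
    toFaults-isFault (inj₂ e ∷ ok) = inj₂ (to-adj e) ∷ toFaults-isFault ok

    faulty-to : ∀ {F w} → Faulty F w → Faulty (toFaults F) (to w)
    faulty-to (here (inj₁ w≡y)) = here (inj₁ (cong to w≡y))
    faulty-to (here (inj₂ w≡z)) = here (inj₂ (cong to w≡z))
    faulty-to (there f) = there (faulty-to f)

    faulty-from : ∀ {F w} → Faulty (toFaults F) (to w) → Faulty F w
    faulty-from {w = w} f = subst (Faulty _) (from∘to w) (go f)
      where
      go : ∀ {F w′} → Faulty (toFaults F) w′ → Faulty F (from w′)
      go {_ ∷ _} (here (inj₁ eq)) = here (inj₁ (trans (cong from eq) (from∘to _)))
      go {_ ∷ _} (here (inj₂ eq)) = here (inj₂ (trans (cong from eq) (from∘to _)))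
      go {_ ∷ _} (there f) = there (go f)

  FaultTolerant-transport : ∀ g → FaultTolerant E′ g → FaultTolerant E g
  FaultTolerant-transport g tolerant F ok small {u} {v} u-live v-live =
    retract-endpoints (gmap from pull (tolerant (toFaults F) (toFaults-isFault ok)
      (subst (_≤ g) (sym (length-map _ F)) small)
      (λ f → u-live (faulty-from f)) (λ f → v-live (faulty-from f))))
    where
    live-from : ∀ {w} → ¬ Faulty (toFaults F) w → ¬ Faulty F (from w)
    live-from {w} live f = live (subst (Faulty (toFaults F)) (to∘from w) (faulty-to f))
    pull : ∀ {a b} → LiveEdge E′ (toFaults F) a b → LiveEdge E F (from a) (from b)
    pull (e , a-live , b-live) = from-adj e , live-from a-live , live-from b-live
    retract-endpoints : Path E F (from (to u)) (from (to v)) → Path E F u v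
    retract-endpoints p rewrite from∘to u | from∘to v = p

-- Counting

MoreThan : ℕ → Set → Set
MoreThan n W = (ys : List W) → length ys ≤ n → ∃[ x ] x ∉ ys

MoreThan-weaken : ∀ {m n W} → m ≤ n → MoreThan n W → MoreThan m W
MoreThan-weaken m≤n more ys short = more ys (≤-trans short m≤n)

tailsAfter : ∀ {n} → Bool → List (Vec Bool (suc n)) → List (Vec Bool n)
tailsAfter b [] = []
tailsAfter false ((false ∷ t) ∷ ys) = t ∷ tailsAfter false ys
tailsAfter false ((true ∷ _) ∷ ys) = tailsAfter false ys
tailsAfter true ((false ∷ _) ∷ ys) = tailsAfter true ys
tailsAfter true ((true ∷ t) ∷ ys) = t ∷ tailsAfter true ys

length-tailsAfter : ∀ {n} (ys : List (Vec Bool (suc n))) →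
  length (tailsAfter false ys) + length (tailsAfter true ys) ≡ length ys
length-tailsAfter [] = refl
length-tailsAfter ((false ∷ _) ∷ ys) = cong suc (length-tailsAfter ys)
length-tailsAfter ((true ∷ _) ∷ ys) = trans (+-suc _ _) (cong suc (length-tailsAfter ys))

∈-tailsAfter : ∀ {n b} {t : Vec Bool n} (ys : List (Vec Bool (suc n))) → (b ∷ t) ∈ ys → t ∈ tailsAfter b ys
∈-tailsAfter {b = false} ((false ∷ _) ∷ ys) (here refl) = here refl
∈-tailsAfter {b = true} ((true ∷ _) ∷ ys) (here refl) = here refl
∈-tailsAfter {b = false} ((false ∷ _) ∷ ys) (there m) = there (∈-tailsAfter ys m)
∈-tailsAfter {b = false} ((true ∷ _) ∷ ys) (there m) = ∈-tailsAfter ys m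
∈-tailsAfter {b = true} ((false ∷ _) ∷ ys) (there m) = ∈-tailsAfter ys m
∈-tailsAfter {b = true} ((true ∷ _) ∷ ys) (there m) = there (∈-tailsAfter ys m)

-- Some half of ys, split by the first bit, is shorter than 2 ^ n.
pigeonhole : ∀ n (ys : List (Vec Bool n)) → length ys < 2 ^ n → ∃[ x ] x ∉ ys
pigeonhole zero [] _ = [] , λ ()
pigeonhole zero (_ ∷ _) (s≤s ())
pigeonhole (suc n) ys short with length (tailsAfter false ys) <? 2 ^ n
... | yes fewer with pigeonhole n (tailsAfter false ys) fewer
...   | t , t∉ = false ∷ t , λ m → t∉ (∈-tailsAfter ys m)
pigeonhole (suc n) ys short | no many with pigeonhole n (tailsAfter true ys) fewer
  where
  fewer : length (tailsAfter true ys) < 2 ^ n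
  fewer = +-cancelˡ-< (2 ^ n) _ _ (≤-<-trans (+-monoˡ-≤ _ (≮⇒≥ many))
            (subst₂ _<_ (sym (length-tailsAfter ys)) (cong (2 ^ n +_) (+-identityʳ (2 ^ n))) short))
... | t , t∉ = true ∷ t , λ m → t∉ (∈-tailsAfter ys m)

4+e≤2^[2+e] : ∀ e → 4 + e ≤ 2 ^ (2 + e)
4+e≤2^[2+e] zero = s≤s (s≤s (s≤s (s≤s z≤n)))
4+e≤2^[2+e] (suc e) = subst₂ _≤_ (trans (+-comm (4 + e) 1) (sym (+-suc 4 e))) refl
  (+-mono-≤ (4+e≤2^[2+e] e) (+-monoˡ-≤ 0 (m^n>0 2 (2 + e))))

enough-copies : ∀ e → 2 + 4 * (3 + e) < 2 ^ 2 ^ (2 + e)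
enough-copies e = begin-strict
  2 + 4 * (3 + e)   <⟨ +-monoˡ-< (4 * (3 + e)) {2} {4} (s≤s (s≤s (s≤s z≤n))) ⟩
  4 + 4 * (3 + e)   ≡⟨ sym (*-suc 4 (3 + e)) ⟩
  4 * (4 + e)       ≤⟨ *-monoʳ-≤ 4 (4+e≤2^[2+e] e) ⟩
  4 * 2 ^ (2 + e)   ≡⟨ *-assoc 2 2 (2 ^ (2 + e)) ⟩
  2 ^ (4 + e)       ≤⟨ ^-monoʳ-≤ 2 (4+e≤2^[2+e] e) ⟩
  2 ^ 2 ^ (2 + e)   ∎
  where open ≤-Reasoning

Vertex-moreThan : ∀ e → MoreThan (2 + 4 * (3 + e)) (Vertex (2 + e))
Vertex-moreThan e ys short = pigeonhole (2 ^ (2 + e)) ys (≤-<-trans short (enough-copies e))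

-- The swap product

module SwapProduct {W : Set} (_≟_ : DecidableEquality W)
  (comp : W → W) (comp-involutive : ∀ x → comp (comp x) ≡ x) (comp-≢ : ∀ x → comp x ≢ x)
  (A : W → W → Set) where

  -- (L , R) is the vertex L of the copy R; the copies are joined by the level-1 move of FDSC.
  V : Set
  V = W × W

  cross : V → V
  cross (L , R) with L ≟ R
  ... | yes _ = comp L , comp R
  ... | no _ = R , L

  Link : V → V → Set
  Link u v = (proj₂ u ≡ proj₂ v × A (proj₁ u) (proj₁ v)) ⊎ (v ≡ cross u)

  cross-≢ : ∀ {L R} → L ≢ R → cross (L , R) ≡ (R , L)
  cross-≢ {L} {R} L≢R with L ≟ R
  ... | yes L≡R = ⊥-elim (L≢R L≡R)
  ... | no _ = refl

  cross-diagonal : ∀ L → cross (L , L) ≡ (comp L , comp L)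
  cross-diagonal L with L ≟ L
  ... | yes _ = refl
  ... | no L≢L = ⊥-elim (L≢L refl)

  cross-involutive : ∀ v → cross (cross v) ≡ v
  cross-involutive (L , R) with L ≟ R
  ... | yes refl = trans (cross-diagonal (comp L)) (cong₂ _,_ (comp-involutive L) (comp-involutive L))
  ... | no L≢R = cross-≢ (λ R≡L → L≢R (sym R≡L))

  cross-injective : ∀ {u v} → cross u ≡ cross v → u ≡ v
  cross-injective {u} {v} eq =
    trans (sym (cross-involutive u)) (trans (cong cross eq) (cross-involutive v))

  cross-changes-copy : ∀ v → proj₂ (cross v) ≢ proj₂ v
  cross-changes-copy (L , R) with L ≟ R
  ... | yes refl = comp-≢ L
  ... | no L≢R = L≢R

  -- The copy reached from (x , C) is x, except that (C , C) leads to comp C.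
  copy-cross-collision : ∀ {x₁ x₂ C} → x₁ ≢ x₂ →
    proj₂ (cross (x₁ , C)) ≡ proj₂ (cross (x₂ , C)) → x₂ ≡ comp x₁
  copy-cross-collision {x₁} {x₂} {C} x₁≢x₂ eq with x₁ ≟ C | x₂ ≟ C
  ... | yes refl | yes refl = ⊥-elim (x₁≢x₂ refl)
  ... | yes refl | no _ = sym eq
  ... | no _ | yes refl = trans (sym (comp-involutive x₂)) (cong comp (sym eq))
  ... | no _ | no _ = ⊥-elim (x₁≢x₂ eq)

  _≟V_ : DecidableEquality V
  _≟V_ = ×-≡-dec _≟_ _≟_

  Path× : List (V × V) → V → V → Set
  Path× = Path Link

  Meets : W → V × V → Set
  Meets R p = (proj₂ (proj₁ p) ≡ R) ⊎ (proj₂ (proj₂ p) ≡ R)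

  -- A fault with only one end in copy R becomes a vertex fault of that copy.
  slice : W → List (V × V) → List (W × W)
  slice R [] = []
  slice R (((Ly , Ry) , (Lz , Rz)) ∷ F) with Ry ≟ R | Rz ≟ R
  ... | yes _ | yes _ = (Ly , Lz) ∷ slice R F
  ... | yes _ | no _ = (Ly , Ly) ∷ slice R F
  ... | no _ | yes _ = (Lz , Lz) ∷ slice R F
  ... | no _ | no _ = slice R F

  faulty-slice⁺ : ∀ F {L R} → Faulty F (L , R) → Faulty (slice R F) L
  faulty-slice⁺ (((Ly , Ry) , (Lz , Rz)) ∷ F) {R = R} f with Ry ≟ R | Rz ≟ R | f
  ... | yes _ | yes _ | here (inj₁ refl) = here (inj₁ refl)
  ... | yes _ | yes _ | here (inj₂ refl) = here (inj₂ refl)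
  ... | yes _ | no _ | here (inj₁ refl) = here (inj₁ refl)
  ... | no Ry≢R | _ | here (inj₁ refl) = ⊥-elim (Ry≢R refl)
  ... | no _ | yes _ | here (inj₂ refl) = here (inj₁ refl)
  ... | _ | no Rz≢R | here (inj₂ refl) = ⊥-elim (Rz≢R refl)
  ... | yes _ | yes _ | there f′ = there (faulty-slice⁺ F f′)
  ... | yes _ | no _ | there f′ = there (faulty-slice⁺ F f′)
  ... | no _ | yes _ | there f′ = there (faulty-slice⁺ F f′)
  ... | no _ | no _ | there f′ = faulty-slice⁺ F f′

  faulty-slice⁻ : ∀ F {L R} → Faulty (slice R F) L → Faulty F (L , R)
  faulty-slice⁻ (((Ly , Ry) , (Lz , Rz)) ∷ F) {R = R} f with Ry ≟ R | Rz ≟ R | f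
  ... | yes refl | yes _ | here (inj₁ refl) = here (inj₁ refl)
  ... | yes _ | yes refl | here (inj₂ refl) = here (inj₂ refl)
  ... | yes refl | no _ | here (inj₁ refl) = here (inj₁ refl)
  ... | yes refl | no _ | here (inj₂ refl) = here (inj₁ refl)
  ... | no _ | yes refl | here (inj₁ refl) = here (inj₂ refl)
  ... | no _ | yes refl | here (inj₂ refl) = here (inj₂ refl)
  ... | yes _ | yes _ | there f′ = there (faulty-slice⁻ F f′)
  ... | yes _ | no _ | there f′ = there (faulty-slice⁻ F f′)
  ... | no _ | yes _ | there f′ = there (faulty-slice⁻ F f′)
  ... | no _ | no _ | f′ = there (faulty-slice⁻ F f′)

  slice-isFault : ∀ F {R} → All (IsFault Link) F → All (IsFault A) (slice R F)
  slice-isFault [] [] = []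
  slice-isFault (((Ly , Ry) , (Lz , Rz)) ∷ F) {R} (ok ∷ oks) with Ry ≟ R | Rz ≟ R
  ... | yes refl | yes refl = inside ok ∷ slice-isFault F oks
    where
    inside : IsFault Link ((Ly , Ry) , (Lz , Ry)) → IsFault A (Ly , Lz)
    inside (inj₁ y≡z) = inj₁ (cong proj₁ y≡z)
    inside (inj₂ (inj₁ (_ , a))) = inj₂ a
    inside (inj₂ (inj₂ z≡cross)) = ⊥-elim (cross-changes-copy (Ly , Ry) (cong proj₂ (sym z≡cross)))
  ... | yes _ | no _ = inj₁ refl ∷ slice-isFault F oks
  ... | no _ | yes _ = inj₁ refl ∷ slice-isFault F oks
  ... | no _ | no _ = slice-isFault F oks

  length-slice : ∀ F {R} → length (slice R F) ≤ length F
  length-slice [] = z≤n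
  length-slice (((Ly , Ry) , (Lz , Rz)) ∷ F) {R} with Ry ≟ R | Rz ≟ R
  ... | yes _ | yes _ = s≤s (length-slice F)
  ... | yes _ | no _ = s≤s (length-slice F)
  ... | no _ | yes _ = s≤s (length-slice F)
  ... | no _ | no _ = m≤n⇒m≤1+n (length-slice F)

  slice-full : ∀ F {R} → length F ≤ length (slice R F) → All (Meets R) F
  slice-full [] _ = []
  slice-full (((Ly , Ry) , (Lz , Rz)) ∷ F) {R} full with Ry ≟ R | Rz ≟ R
  ... | yes Ry≡R | yes _ = inj₁ Ry≡R ∷ slice-full F (s≤s⁻¹ full)
  ... | yes Ry≡R | no _ = inj₁ Ry≡R ∷ slice-full F (s≤s⁻¹ full)
  ... | no _ | yes Rz≡R = inj₂ Rz≡R ∷ slice-full F (s≤s⁻¹ full)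
  ... | no _ | no _ = ⊥-elim (1+n≰n (≤-trans full (length-slice F)))

  record FewFaultsIn (g : ℕ) (F : List (V × V)) (R : W) : Set where
    field
      faults : List (W × W)
      isFault : All (IsFault A) faults
      few : length faults ≤ g
      faulty⁺ : ∀ {L} → Faulty F (L , R) → Faulty faults L
      faulty⁻ : ∀ {L} → Faulty faults L → Faulty F (L , R)

  fewFaults-slice : ∀ {g F R} → All (IsFault Link) F → length (slice R F) ≤ g → FewFaultsIn g F R
  fewFaults-slice {F = F} ok few = record
    { faults = slice _ F ; isFault = slice-isFault F ok ; few = few
    ; faulty⁺ = faulty-slice⁺ F ; faulty⁻ = faulty-slice⁻ F }

  fewFaults-none : ∀ {g F R} → (∀ {L} → ¬ Faulty F (L , R)) → FewFaultsIn g F R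
  fewFaults-none none = record
    { faults = [] ; isFault = [] ; few = z≤n ; faulty⁺ = λ f → ⊥-elim (none f) ; faulty⁻ = λ () }

  fewFaults-one : ∀ {g F R} → 1 ≤ g → (w : W) → (∀ {L} → Faulty F (L , R) → L ≡ w) →
    FewFaultsIn g F R
  fewFaults-one {F = F} {R} 1≤g w only-w with faulty? _≟V_ F (w , R)
  ... | no w-live = fewFaults-none (λ f → w-live (subst (λ L → Faulty F (L , R)) (only-w f) f))
  ... | yes w-faulty = record
    { faults = (w , w) ∷ [] ; isFault = inj₁ refl ∷ [] ; few = 1≤g
    ; faulty⁺ = λ f → here (inj₁ (only-w f))
    ; faulty⁻ = λ { (here (inj₁ refl)) → w-faulty ; (here (inj₂ refl)) → w-faulty } }

  liftPath : ∀ {F F′ R} → (∀ {L} → Faulty F (L , R) → Faulty F′ L) →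
    ∀ {L L′} → Path A F′ L L′ → Path× F (L , R) (L′ , R)
  liftPath faulty⁺ = gmap (_, _) λ (a , l-live , l′-live) →
    inj₁ (refl , a) , (λ f → l-live (faulty⁺ f)) , (λ f → l′-live (faulty⁺ f))

  CopyConnected : List (V × V) → W → Set
  CopyConnected F R = ∀ {L L′} → ¬ Faulty F (L , R) → ¬ Faulty F (L′ , R) →
    Path× F (L , R) (L′ , R)

  sliceConnected : ∀ F {R} → ConnectedAfter A (slice R F) → CopyConnected F R
  sliceConnected F connected l-live l′-live =
    liftPath (faulty-slice⁺ F)
      (connected (λ f → l-live (faulty-slice⁻ F f)) (λ f → l′-live (faulty-slice⁻ F f)))

  record Escape (F : List (V × V)) (u : V) : Set where
    field
      target : V
      target-live : ¬ Faulty F target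
      target-copy : CopyConnected F (proj₂ target)
      path-to : Path× F u target
      path-from : Path× F target u

  escape-stay : ∀ {F u} → ¬ Faulty F u → CopyConnected F (proj₂ u) → Escape F u
  escape-stay {u = u} u-live connected = record
    { target = u ; target-live = u-live ; target-copy = connected ; path-to = ε ; path-from = ε }

  escape-cross : ∀ {F u} → ¬ Faulty F u → ¬ Faulty F (cross u) →
    CopyConnected F (proj₂ (cross u)) → Escape F u
  escape-cross {u = u} u-live cross-live connected = record
    { target = cross u ; target-live = cross-live ; target-copy = connected
    ; path-to = (inj₂ refl , u-live , cross-live) ◅ ε
    ; path-from = (inj₂ (sym (cross-involutive u)) , cross-live , u-live) ◅ ε }

  coords : List (V × V) → List W
  coords [] = []
  coords (((Ly , Ry) , (Lz , Rz)) ∷ F) = Ly ∷ Ry ∷ Lz ∷ Rz ∷ coords F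

  length-coords : ∀ F → length (coords F) ≡ 4 * length F
  length-coords [] = refl
  length-coords (_ ∷ F) = trans (cong (4 +_) (length-coords F)) (sym (*-suc 4 (length F)))

  faulty⇒copy∈coords : ∀ F {L R} → Faulty F (L , R) → R ∈ coords F
  faulty⇒copy∈coords (_ ∷ F) (here (inj₁ refl)) = there (here refl)
  faulty⇒copy∈coords (_ ∷ F) (here (inj₂ refl)) = there (there (there (here refl)))
  faulty⇒copy∈coords (_ ∷ F) (there f) = there (there (there (there (faulty⇒copy∈coords F f))))

  faulty⇒vertex∈coords : ∀ F {L R} → Faulty F (L , R) → L ∈ coords F
  faulty⇒vertex∈coords (_ ∷ F) (here (inj₁ refl)) = here refl
  faulty⇒vertex∈coords (_ ∷ F) (here (inj₂ refl)) = there (there (here refl))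
  faulty⇒vertex∈coords (_ ∷ F) (there f) = there (there (there (there (faulty⇒vertex∈coords F f))))

  hits-across : ∀ {C p w} → IsFault Link p → Meets C p → Hits w p → proj₂ w ≢ C →
    ∃[ o ] Hits o p × proj₂ o ≡ C × w ≡ cross o
  hits-across (inj₁ refl) meets h w∉C = ⊥-elim (w∉C (trans (cong proj₂ (reduce h)) (reduce meets)))
  hits-across (inj₂ (inj₁ _)) (inj₁ y∈C) (inj₁ refl) w∉C = ⊥-elim (w∉C y∈C)
  hits-across (inj₂ (inj₁ (same , _))) (inj₂ z∈C) (inj₁ refl) w∉C = ⊥-elim (w∉C (trans same z∈C))
  hits-across (inj₂ (inj₁ (same , _))) (inj₁ y∈C) (inj₂ refl) w∉C = ⊥-elim (w∉C (trans (sym same) y∈C))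
  hits-across (inj₂ (inj₁ _)) (inj₂ z∈C) (inj₂ refl) w∉C = ⊥-elim (w∉C z∈C)
  hits-across (inj₂ (inj₂ _)) (inj₁ y∈C) (inj₁ refl) w∉C = ⊥-elim (w∉C y∈C)
  hits-across {p = y , z} (inj₂ (inj₂ z≡cross)) (inj₂ z∈C) (inj₁ refl) w∉C =
    z , inj₂ refl , z∈C , trans (sym (cross-involutive y)) (cong cross (sym z≡cross))
  hits-across {p = y , z} (inj₂ (inj₂ z≡cross)) (inj₁ y∈C) (inj₂ refl) w∉C =
    y , inj₁ refl , y∈C , z≡cross
  hits-across (inj₂ (inj₂ _)) (inj₂ z∈C) (inj₂ refl) w∉C = ⊥-elim (w∉C z∈C)

  faulty-across : ∀ {F C w} → All (IsFault Link) F → All (Meets C) F → Faulty F w → proj₂ w ≢ C →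
    ∃[ o ] Faulty F o × proj₂ o ≡ C × w ≡ cross o
  faulty-across (ok ∷ _) (meets ∷ _) (here h) w∉C with hits-across ok meets h w∉C
  ... | o , ho , o∈C , w≡cross = o , here ho , o∈C , w≡cross
  faulty-across (_ ∷ oks) (_ ∷ meets) (there f) w∉C with faulty-across oks meets f w∉C
  ... | o , fo , o∈C , w≡cross = o , there fo , o∈C , w≡cross

  module Tolerant {g : ℕ} (1≤g : 1 ≤ g) (tolerant : FaultTolerant A g) where

    copyConnected : ∀ {F R} → FewFaultsIn g F R → CopyConnected F R
    copyConnected fewer l-live l′-live =
      liftPath faulty⁺ (tolerant faults isFault few
        (λ f → l-live (faulty⁻ f)) (λ f → l′-live (faulty⁻ f)))
      where open FewFaultsIn fewer

    -- Through a copy X avoided by every fault: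
    -- (La , Ra) ⋯ (X , Ra) ─ (Ra , X) ⋯ (Rb , X) ─ (X , Rb) ⋯ (Lb , Rb).
    bridge : ∀ {F La Ra Lb Rb X} → X ∉ Ra ∷ Rb ∷ coords F →
      ¬ Faulty F (La , Ra) → ¬ Faulty F (Lb , Rb) → CopyConnected F Ra → CopyConnected F Rb →
      Path× F (La , Ra) (Lb , Rb)
    bridge {F} {Ra = Ra} {Rb = Rb} {X} X∉ a-live b-live a-copy b-copy =
      a-copy a-live (live₁ Ra) ◅◅
      (inj₂ (sym (cross-≢ λ X≡Ra → X∉ (here X≡Ra))) , live₁ Ra , live₂ Ra) ◅
      copyConnected (fewFaults-none (λ f → X∉ (there (there (faulty⇒copy∈coords F f)))))
        (live₂ Ra) (live₂ Rb) ◅◅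
      (inj₂ (sym (cross-≢ λ Rb≡X → X∉ (there (here (sym Rb≡X))))) , live₂ Rb , live₁ Rb) ◅
      b-copy (live₁ Rb) b-live
      where
      live₁ : ∀ R → ¬ Faulty F (X , R)
      live₁ R f = X∉ (there (there (faulty⇒vertex∈coords F f)))
      live₂ : ∀ R → ¬ Faulty F (R , X)
      live₂ R f = X∉ (there (there (faulty⇒copy∈coords F f)))

    connected-if-escapes : ∀ h → MoreThan (2 + 4 * h) W →
      (∀ F → All (IsFault Link) F → length F ≤ h → ∀ u → ¬ Faulty F u → Escape F u) →
      FaultTolerant Link h
    connected-if-escapes h more escape F ok small {u} {v} u-live v-live =
      path-to eu ◅◅ bridge X∉ (target-live eu) (target-live ev) (target-copy eu) (target-copy ev) ◅◅ path-from ev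
      where
      open Escape
      eu = escape F ok small u u-live
      ev = escape F ok small v v-live
      fresh = more (proj₂ (target eu) ∷ proj₂ (target ev) ∷ coords F)
        (s≤s (s≤s (subst (_≤ 4 * h) (sym (length-coords F)) (*-monoʳ-≤ 4 small))))
      X∉ = proj₂ fresh

    -- If every fault meets the copy C of u, then u escapes along its cross edge: the copy
    -- it reaches contains at most the one faulty vertex coming from (comp Lu , C).
    escape-full : ∀ {F C Lu} → All (IsFault Link) F → All (Meets C) F →
      ¬ Faulty F (Lu , C) → Escape F (Lu , C)
    escape-full {F} {C} {Lu} ok meets u-live =
      escape-cross u-live cross-live (copyConnected (fewFaults-one 1≤g _ only-one))
      where
      cross-live : ¬ Faulty F (cross (Lu , C))
      cross-live f with faulty-across ok meets f (cross-changes-copy (Lu , C))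
      ... | o , fo , refl , eq = u-live (subst (Faulty F) (sym (cross-injective eq)) fo)
      only-one : ∀ {L} → Faulty F (L , proj₂ (cross (Lu , C))) → L ≡ proj₁ (cross (comp Lu , C))
      only-one f with faulty-across ok meets f (cross-changes-copy (Lu , C))
      ... | (Lo , _) , fo , refl , eq =
        trans (cong proj₁ eq) (cong (λ x → proj₁ (cross (x , C))) Lo≡comp-Lu)
        where
        Lo≡comp-Lu : Lo ≡ comp Lu
        Lo≡comp-Lu = copy-cross-collision (λ Lu≡Lo → u-live (subst (λ L → Faulty F (L , C)) (sym Lu≡Lo) fo))
          (cong proj₂ eq)

    escape-general : ∀ F → All (IsFault Link) F → length F ≤ suc g →
      ∀ u → ¬ Faulty F u → Escape F u
    escape-general F ok small (Lu , C) u-live with length (slice C F) ≤? g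
    ... | yes few = escape-stay u-live (copyConnected (fewFaults-slice ok few))
    ... | no many = escape-full ok (slice-full F (≤-trans small (≰⇒> many))) u-live

  outside : W → List (V × V) → List (V × V)
  outside R [] = []
  outside R (((Ly , Ry) , (Lz , Rz)) ∷ F) with Ry ≟ R | Rz ≟ R
  ... | yes _ | yes _ = outside R F
  ... | yes _ | no _ = outside R F
  ... | no _ | yes _ = outside R F
  ... | no _ | no _ = ((Ly , Ry) , (Lz , Rz)) ∷ outside R F

  length-slice+outside : ∀ F {R} → length (slice R F) + length (outside R F) ≡ length F
  length-slice+outside [] = refl
  length-slice+outside (((Ly , Ry) , (Lz , Rz)) ∷ F) {R} with Ry ≟ R | Rz ≟ R
  ... | yes _ | yes _ = cong suc (length-slice+outside F)
  ... | yes _ | no _ = cong suc (length-slice+outside F)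
  ... | no _ | yes _ = cong suc (length-slice+outside F)
  ... | no _ | no _ = trans (+-suc _ _) (cong suc (length-slice+outside F))

  outside-isFault : ∀ F {R} → All (IsFault Link) F → All (IsFault Link) (outside R F)
  outside-isFault [] [] = []
  outside-isFault (((Ly , Ry) , (Lz , Rz)) ∷ F) {R} (ok ∷ oks) with Ry ≟ R | Rz ≟ R
  ... | yes _ | yes _ = outside-isFault F oks
  ... | yes _ | no _ = outside-isFault F oks
  ... | no _ | yes _ = outside-isFault F oks
  ... | no _ | no _ = ok ∷ outside-isFault F oks

  faulty-outside⁻ : ∀ F {R w} → Faulty (outside R F) w → Faulty F w
  faulty-outside⁻ (((Ly , Ry) , (Lz , Rz)) ∷ F) {R} f with Ry ≟ R | Rz ≟ R | f
  ... | yes _ | yes _ | f′ = there (faulty-outside⁻ F f′)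
  ... | yes _ | no _ | f′ = there (faulty-outside⁻ F f′)
  ... | no _ | yes _ | f′ = there (faulty-outside⁻ F f′)
  ... | no _ | no _ | here h = here h
  ... | no _ | no _ | there f′ = there (faulty-outside⁻ F f′)

  -- When the faults meeting R all slice to edges, they lie entirely inside the copy R.
  faulty-outside⁺ : ∀ F {R w} → All NonDiagonal (slice R F) → proj₂ w ≢ R → Faulty F w →
    Faulty (outside R F) w
  faulty-outside⁺ (((Ly , Ry) , (Lz , Rz)) ∷ F) {R} nd w∉R f with Ry ≟ R | Rz ≟ R | nd | f
  ... | yes Ry≡R | yes _ | _ | here (inj₁ refl) = ⊥-elim (w∉R Ry≡R)
  ... | yes _ | yes Rz≡R | _ | here (inj₂ refl) = ⊥-elim (w∉R Rz≡R)
  ... | yes _ | yes _ | _ ∷ nd′ | there f′ = faulty-outside⁺ F nd′ w∉R f′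
  ... | yes _ | no _ | diagonal ∷ _ | _ = ⊥-elim (diagonal refl)
  ... | no _ | yes _ | diagonal ∷ _ | _ = ⊥-elim (diagonal refl)
  ... | no _ | no _ | _ | here h = here h
  ... | no _ | no _ | nd′ | there f′ = there (faulty-outside⁺ F nd′ w∉R f′)

  hits-two-copies : ∀ {p a b} → IsFault Link p → Hits a p → Hits b p → proj₂ a ≢ proj₂ b →
    (b ≡ cross a) ⊎ (a ≡ cross b)
  hits-two-copies (inj₁ refl) ha hb a≁b = ⊥-elim (a≁b (cong proj₂ (trans (reduce ha) (sym (reduce hb)))))
  hits-two-copies _ (inj₁ refl) (inj₁ refl) a≁b = ⊥-elim (a≁b refl)
  hits-two-copies _ (inj₂ refl) (inj₂ refl) a≁b = ⊥-elim (a≁b refl)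
  hits-two-copies (inj₂ (inj₁ (same , _))) (inj₁ refl) (inj₂ refl) a≁b = ⊥-elim (a≁b same)
  hits-two-copies (inj₂ (inj₁ (same , _))) (inj₂ refl) (inj₁ refl) a≁b = ⊥-elim (a≁b (sym same))
  hits-two-copies (inj₂ (inj₂ z≡cross)) (inj₁ refl) (inj₂ refl) _ = inj₁ z≡cross
  hits-two-copies (inj₂ (inj₂ z≡cross)) (inj₂ refl) (inj₁ refl) _ = inj₂ z≡cross

  escape-via : ∀ {F u v} → Path× F u v → Path× F v u → Escape F v → Escape F u
  escape-via to from e = record
    { target = target ; target-live = target-live ; target-copy = target-copy
    ; path-to = to ◅◅ path-to ; path-from = path-from ◅◅ from }
    where open Escape e

  VertexPlusFaultTolerant : Set
  VertexPlusFaultTolerant = ∀ y q → IsFault A q → ConnectedAfter A ((y , y) ∷ q ∷ [])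

  LargeComponents : Set
  LargeComponents = ∀ p q → IsFault A p → IsFault A q → NonDiagonal p → NonDiagonal q →
    ∀ x → ¬ Faulty (p ∷ q ∷ []) x →
    ∃[ w ] ¬ Faulty (p ∷ q ∷ []) w × w ≢ x × w ≢ comp x ×
      Path A (p ∷ q ∷ []) x w × Path A (p ∷ q ∷ []) w x

  fewFaults-outside : ∀ {g F C Y} → All (IsFault Link) F → All NonDiagonal (slice C F) →
    length (outside C F) ≤ g → Y ≢ C → FewFaultsIn g F Y
  fewFaults-outside {F = F} {C} ok nd few Y≢C = record
    { faults = slice _ (outside C F)
    ; isFault = slice-isFault _ (outside-isFault F ok)
    ; few = ≤-trans (length-slice (outside C F)) few
    ; faulty⁺ = λ f → faulty-slice⁺ _ (faulty-outside⁺ F nd Y≢C f)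
    ; faulty⁻ = λ f → faulty-outside⁻ F (faulty-slice⁻ _ f) }

  single-fault-across : ∀ {F a b} → length F ≤ 1 → All (IsFault Link) F →
    Faulty F a → Faulty F b → proj₂ a ≢ proj₂ b → (b ≡ cross a) ⊎ (a ≡ cross b)
  single-fault-across _ (ok ∷ []) (here ha) (here hb) a≁b = hits-two-copies ok ha hb a≁b
  single-fault-across (s≤s ()) (_ ∷ _ ∷ _) _ _ _

  faulty-swap : ∀ {p q} {w : W} → Faulty (p ∷ q ∷ []) w → Faulty (q ∷ p ∷ []) w
  faulty-swap (here h) = there (here h)
  faulty-swap (there (here h)) = here h

  tolerant-one : VertexPlusFaultTolerant → MoreThan 2 W → FaultTolerant A 1
  tolerant-one vertexPlusFault more [] [] _ {u} {v} u-live v-live with more (u ∷ v ∷ []) ≤-refl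
  ... | w , w∉ = Path-antitone (λ ())
    (vertexPlusFault w (w , w) (inj₁ refl) (avoid (w∉ ∘ here)) (avoid (w∉ ∘ there ∘ here)))
    where
    avoid : ∀ {x} → w ≢ x → ¬ Faulty ((w , w) ∷ (w , w) ∷ []) x
    avoid w≢x (here h) = w≢x (sym (reduce h))
    avoid w≢x (there (here h)) = w≢x (sym (reduce h))
  tolerant-one vertexPlusFault more (p ∷ []) (ok ∷ []) _ u-live v-live =
    Path-antitone there (vertexPlusFault (proj₁ p) p ok (widen u-live) (widen v-live))
    where
    widen : ∀ {x} → ¬ Faulty (p ∷ []) x → ¬ Faulty ((proj₁ p , proj₁ p) ∷ p ∷ []) x
    widen live (here h) = live (here (inj₁ (reduce h)))
    widen live (there f) = live f
  tolerant-one _ _ (_ ∷ _ ∷ _) _ (s≤s ())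

  module BaseCase (vertexPlusFault : VertexPlusFaultTolerant) (largeComponents : LargeComponents)
    (more : MoreThan 14 W) where

    open Tolerant ≤-refl (tolerant-one vertexPlusFault (MoreThan-weaken (s≤s (s≤s z≤n)) more))

    outside-connected : ∀ {F C} x → All (IsFault Link) F → All NonDiagonal (slice C F) →
      length (outside C F) ≤ 1 → CopyConnected F (proj₂ (cross (x , C)))
    outside-connected {C = C} x ok nd few =
      copyConnected (fewFaults-outside ok nd few (cross-changes-copy (x , C)))

    -- Of the cross edges leaving (Lu , C) and (w , C), the single fault outside C can cut only one.
    escape-spread : ∀ {F C Lu w} → All (IsFault Link) F → All NonDiagonal (slice C F) →
      length (outside C F) ≤ 1 → ¬ Faulty F (Lu , C) → ¬ Faulty F (w , C) →
      w ≢ Lu → w ≢ comp Lu → Path× F (Lu , C) (w , C) → Path× F (w , C) (Lu , C) → Escape F (Lu , C)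
    escape-spread {F} {C} {Lu} {w} ok nd few u-live w-live w≢Lu w≢comp to from
      with faulty? _≟V_ F (cross (Lu , C)) | faulty? _≟V_ F (cross (w , C))
    ... | no cu-live | _ = escape-cross u-live cu-live (outside-connected Lu ok nd few)
    ... | yes _ | no cw-live = escape-via to from (escape-cross w-live cw-live (outside-connected w ok nd few))
    ... | yes cu-faulty | yes cw-faulty = ⊥-elim (not-both (single-fault-across few (outside-isFault F ok)
          (outside⁺ cu-faulty) (outside⁺ cw-faulty)
          (λ same → w≢comp (copy-cross-collision (λ Lu≡w → w≢Lu (sym Lu≡w)) same))))
      where
      outside⁺ : ∀ {x} → Faulty F (cross (x , C)) → Faulty (outside C F) (cross (x , C))
      outside⁺ {x} = faulty-outside⁺ F nd (cross-changes-copy (x , C))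
      not-both : (cross (w , C) ≡ cross (cross (Lu , C))) ⊎ (cross (Lu , C) ≡ cross (cross (w , C))) → ⊥
      not-both (inj₁ eq) = cross-changes-copy (w , C) (cong proj₂ (trans eq (cross-involutive (Lu , C))))
      not-both (inj₂ eq) = cross-changes-copy (Lu , C) (cong proj₂ (trans eq (cross-involutive (w , C))))

    -- If one of the two faults inside C is a vertex, C stays connected. If both are edges, u has a
    -- second exit w, and the one fault outside C cannot block both.
    escape-pair : ∀ {F C Lu p q} → slice C F ≡ p ∷ q ∷ [] → All (IsFault A) (p ∷ q ∷ []) →
      All (IsFault Link) F → length (outside C F) ≤ 1 → ¬ Faulty F (Lu , C) → Escape F (Lu , C)
    escape-pair {F} {C} {Lu} {y , z} {q} eq (p-ok ∷ q-ok ∷ []) ok few u-live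
      with y ≟ z | proj₁ q ≟ proj₂ q
    ... | yes refl | _ =
      escape-stay u-live (sliceConnected F (subst (ConnectedAfter A) (sym eq) (vertexPlusFault y q q-ok)))
    ... | no _ | yes refl =
      escape-stay u-live (sliceConnected F (subst (ConnectedAfter A) (sym eq) λ x-live x′-live →
        Path-antitone faulty-swap (vertexPlusFault (proj₁ q) (y , z) p-ok
          (λ f → x-live (faulty-swap f)) (λ f → x′-live (faulty-swap f)))))
    ... | no p-edge | no q-edge
      with largeComponents (y , z) q p-ok q-ok p-edge q-edge Lu (λ f → u-live (in-copy f))
      where
      in-copy : ∀ {x} → Faulty ((y , z) ∷ q ∷ []) x → Faulty F (x , C)
      in-copy f = faulty-slice⁻ F (subst (λ S → Faulty S _) (sym eq) f)
    ...   | w , w-live , w≢Lu , w≢comp , to , from =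
      escape-spread ok (subst (All NonDiagonal) (sym eq) (p-edge ∷ q-edge ∷ [])) few
        u-live (λ f → w-live (in-slice f)) w≢Lu w≢comp (liftPath in-slice to) (liftPath in-slice from)
      where
      in-slice : ∀ {x} → Faulty F (x , C) → Faulty ((y , z) ∷ q ∷ []) x
      in-slice f = subst (λ S → Faulty S _) eq (faulty-slice⁺ F f)

    escape-three : ∀ F → All (IsFault Link) F → length F ≤ 3 → ∀ u → ¬ Faulty F u → Escape F u
    escape-three F ok small (Lu , C) u-live
      with length (slice C F) ≤? 1 | length F ≤? length (slice C F)
    ... | yes few | _ = escape-stay u-live (copyConnected (fewFaults-slice ok few))
    ... | no _ | yes full = escape-full ok (slice-full F full) u-live
    ... | no many | no partial with slice C F in eq
    ...   | [] = ⊥-elim (many z≤n)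
    ...   | _ ∷ [] = ⊥-elim (many (s≤s z≤n))
    ...   | _ ∷ _ ∷ _ ∷ _ = ⊥-elim (partial (≤-trans small (s≤s (s≤s (s≤s z≤n)))))
    ...   | p ∷ q ∷ [] =
      escape-pair eq (subst (All (IsFault A)) eq (slice-isFault F ok)) ok
        (+-cancelˡ-≤ 2 _ _ (subst (_≤ 3) (sym split) small)) u-live
      where
      split : 2 + length (outside C F) ≡ length F
      split = trans (cong (λ S → length S + length (outside C F)) (sym eq)) (length-slice+outside F)

    tolerant-three : FaultTolerant Link 3
    tolerant-three = connected-if-escapes 3 more escape-three

  tolerant-step : ∀ {g} → 1 ≤ g → FaultTolerant A g → MoreThan (2 + 4 * suc g) W →
    FaultTolerant Link (suc g)
  tolerant-step 1≤g tolerant more = connected-if-escapes _ more escape-general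
    where open Tolerant 1≤g tolerant

-- FDSC on 2^(e+2) bits as the swap product of FDSC on 2^(e+1) bits

-- Adj d u v is definitionally AdjL d (toList u) (toList v).
AdjL : ℕ → List Bool → List Bool → Set
AdjL d u v =
  (v ≡ flipFirst u)
  ⊎ (Σ ℕ λ k → (1 ≤ k) × (k ≤ d) × (v ≡ divSwap d k u))
  ⊎ (v ≡ flipSecond u)

-- divSwap d k is definitionally blockMove (2 ^ (d ∸ k)).
blockMove : ℕ → List Bool → List Bool
blockMove b u =
  let m1 = take b u
      m2 = take b (drop b u)
      m3 = drop (b + b) u
  in if does (List-≡-dec _≟ᵇ_ m1 m2)
       then map not m1 ++ map not m2 ++ m3
       else m2 ++ m1 ++ m3

crossL : List Bool → List Bool → List Bool
crossL L R = if does (List-≡-dec _≟ᵇ_ L R) then map not L ++ map not R ++ [] else R ++ L ++ []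

module _ {A : Set} where

  take-++ˡ : ∀ n (L R : List A) → n ≤ length L → take n (L ++ R) ≡ take n L
  take-++ˡ zero _ _ _ = refl
  take-++ˡ (suc n) (x ∷ L) R (s≤s n≤) = cong (x ∷_) (take-++ˡ n L R n≤)

  drop-++ˡ : ∀ n (L R : List A) → n ≤ length L → drop n (L ++ R) ≡ drop n L ++ R
  drop-++ˡ zero _ _ _ = refl
  drop-++ˡ (suc n) (x ∷ L) R (s≤s n≤) = drop-++ˡ n L R n≤

  take-length-++ : ∀ (L R : List A) → take (length L) (L ++ R) ≡ L
  take-length-++ [] _ = refl
  take-length-++ (x ∷ L) R = cong (x ∷_) (take-length-++ L R)

  drop-length-++ : ∀ (L R : List A) → drop (length L) (L ++ R) ≡ R
  drop-length-++ [] _ = refl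
  drop-length-++ (x ∷ L) R = drop-length-++ L R

blockMove-++ : ∀ b (L R : List Bool) → b + b ≤ length L → blockMove b (L ++ R) ≡ blockMove b L ++ R
blockMove-++ b L R b+b≤
  rewrite take-++ˡ b L R (≤-trans (m≤m+n b b) b+b≤)
        | drop-++ˡ b L R (≤-trans (m≤m+n b b) b+b≤)
        | take-++ˡ b (drop b L) R (subst (b ≤_) (sym (length-drop b L)) (m+n≤o⇒m≤o∸n b b+b≤))
        | drop-++ˡ (b + b) L R b+b≤
  with does (List-≡-dec _≟ᵇ_ (take b L) (take b (drop b L)))
... | true = sym (trans (++-assoc (map not (take b L)) _ R)
               (cong (map not (take b L) ++_) (++-assoc (map not (take b (drop b L))) _ R)))
... | false = sym (trans (++-assoc (take b (drop b L)) _ R)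
                (cong (take b (drop b L) ++_) (++-assoc (take b L) _ R)))

blockMove-halves : ∀ (L R : List Bool) → length L ≡ length R → blockMove (length L) (L ++ R) ≡ crossL L R
blockMove-halves L R same
  rewrite take-length-++ L R | drop-length-++ L R
        | take-all (length L) R (subst (_≤ length L) same ≤-refl)
        | sym (drop-drop (length L) (length L) (L ++ R)) | drop-length-++ L R
        | drop-all (length L) R (subst (_≤ length L) same ≤-refl) = refl

divSwap-first : ∀ e (L R : List Bool) → length L ≡ 2 ^ e → length R ≡ 2 ^ e →
  divSwap (suc e) 1 (L ++ R) ≡ crossL L R
divSwap-first e L R |L| |R| =
  subst (λ b → blockMove b (L ++ R) ≡ crossL L R) |L| (blockMove-halves L R (trans |L| (sym |R|)))

divSwap-later : ∀ e j (L R : List Bool) → j ≤ e → length L ≡ 2 ^ suc e →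
  divSwap (suc (suc e)) (suc (suc j)) (L ++ R) ≡ divSwap (suc e) (suc j) L ++ R
divSwap-later e j L R j≤e |L| = blockMove-++ b L R (subst (b + b ≤_) (sym |L|) two-blocks)
  where
  b = 2 ^ (e ∸ j)
  two-blocks : b + b ≤ 2 ^ suc e
  two-blocks = subst (_≤ 2 ^ suc e) (cong (b +_) (+-identityʳ b)) (^-monoʳ-≤ 2 (s≤s (m∸n≤m e j)))

flipFirst-++ : ∀ (L R : List Bool) → 1 ≤ length L → flipFirst (L ++ R) ≡ flipFirst L ++ R
flipFirst-++ (x ∷ L) R _ = refl

flipSecond-++ : ∀ (L R : List Bool) → 2 ≤ length L → flipSecond (L ++ R) ≡ flipSecond L ++ R
flipSecond-++ (x ∷ y ∷ L) R _ = refl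
flipSecond-++ (x ∷ []) R (s≤s ())

module Halves {e : ℕ} {L R : List Bool} (|L| : length L ≡ 2 ^ suc e) where

  private
    two≤|L| : 2 ≤ length L
    two≤|L| = subst (2 ≤_) (sym |L|) (^-monoʳ-≤ 2 {1} {suc e} (s≤s z≤n))

  adj-inside : ∀ {L′} → AdjL (suc e) L L′ → AdjL (suc (suc e)) (L ++ R) (L′ ++ R)
  adj-inside (inj₁ refl) = inj₁ (sym (flipFirst-++ L R (≤-trans (s≤s z≤n) two≤|L|)))
  adj-inside (inj₂ (inj₂ refl)) = inj₂ (inj₂ (sym (flipSecond-++ L R two≤|L|)))
  adj-inside (inj₂ (inj₁ (suc j , _ , s≤s j≤e , refl))) =
    inj₂ (inj₁ (suc (suc j) , s≤s z≤n , s≤s (s≤s j≤e) , sym (divSwap-later e j L R j≤e |L|)))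

  module _ (|R| : length R ≡ 2 ^ suc e) where

    adj-across : AdjL (suc (suc e)) (L ++ R) (crossL L R)
    adj-across = inj₂ (inj₁ (1 , s≤s z≤n , s≤s z≤n , sym (divSwap-first (suc e) L R |L| |R|)))

    adj-halves : ∀ {W} → AdjL (suc (suc e)) (L ++ R) W →
      (∃[ L′ ] W ≡ L′ ++ R × AdjL (suc e) L L′) ⊎ (W ≡ crossL L R)
    adj-halves (inj₁ refl) = inj₁ (_ , flipFirst-++ L R (≤-trans (s≤s z≤n) two≤|L|) , inj₁ refl)
    adj-halves (inj₂ (inj₂ refl)) = inj₁ (_ , flipSecond-++ L R two≤|L| , inj₂ (inj₂ refl))
    adj-halves (inj₂ (inj₁ (suc zero , _ , _ , refl))) = inj₂ (divSwap-first (suc e) L R |L| |R|)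
    adj-halves (inj₂ (inj₁ (suc (suc j) , _ , s≤s (s≤s j≤e) , refl))) =
      inj₁ (_ , divSwap-later e j L R j≤e |L| , inj₂ (inj₁ (suc j , s≤s z≤n , s≤s j≤e , refl)))

comp : ∀ {n} → Vec Bool n → Vec Bool n
comp = Vec.map not

comp-involutive : ∀ {n} (x : Vec Bool n) → comp (comp x) ≡ x
comp-involutive [] = refl
comp-involutive (b ∷ x) = cong₂ _∷_ (not-involutive b) (comp-involutive x)

comp-≢ : ∀ {n} → 0 < n → (x : Vec Bool n) → comp x ≢ x
comp-≢ _ (false ∷ _) ()
comp-≢ _ (true ∷ _) ()

toList-injective′ : ∀ {n} (x y : Vec Bool n) → toList x ≡ toList y → x ≡ y
toList-injective′ x y eq = trans (sym (cast-is-id refl x)) (toList-injective refl x y eq)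

++-injective-length : ∀ {a b c d : List Bool} → length b ≡ length d → a ++ b ≡ c ++ d → a ≡ c × b ≡ d
++-injective-length {a} {b} {c} {d} |b|≡|d| eq = go (+-cancelʳ-≡ (length b) (length a) (length c) total) eq
  where
  total : length a + length b ≡ length c + length b
  total = trans (sym (length-++ a)) (trans (cong length eq) (trans (length-++ c) (cong (length c +_) (sym |b|≡|d|))))
  go : ∀ {a c} → length a ≡ length c → a ++ b ≡ c ++ d → a ≡ c × b ≡ d
  go {[]} {[]} _ eq = refl , eq
  go {x ∷ a} {y ∷ c} |a|≡|c| eq with go (cong pred |a|≡|c|) (∷-injectiveʳ eq)
  ... | refl , b≡d = cong (_∷ a) (∷-injectiveˡ eq) , b≡d

module Doubling (e : ℕ) where

  open SwapProduct {Vertex (suc e)} (Vec-≡-dec _≟ᵇ_) comp comp-involutive (comp-≢ (m^n>0 2 (suc e)))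
    (Adj (suc e)) public

  private
    half : ℕ
    half = 2 ^ suc e

  split : Vertex (suc (suc e)) → V
  split v = Vec.take half v , Vec.cast (+-identityʳ half) (Vec.drop half v)

  join : V → Vertex (suc (suc e))
  join (L , R) = L Vec.++ Vec.cast (sym (+-identityʳ half)) R

  join∘split : ∀ v → join (split v) ≡ v
  join∘split v = trans (cong (Vec.take half v Vec.++_) (trans (cast-trans _ _ (Vec.drop half v)) (cast-is-id _ _)))
    (take++drop≡id half v)

  split∘join : ∀ p → split (join p) ≡ p
  split∘join (L , R) with ++-injective (Vec.take half (join (L , R))) L (take++drop≡id half (join (L , R)))
  ... | take≡L , drop≡R = cong₂ _,_ take≡L
    (trans (cong (Vec.cast _) drop≡R) (trans (cast-trans _ _ R) (cast-is-id _ R)))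

  toList-join : ∀ L R → toList (join (L , R)) ≡ toList L ++ toList R
  toList-join L R = trans (toList-++ L _) (cong (toList L ++_) (toList-cast _ R))

  toList-join-cross : ∀ L R → toList (join (cross (L , R))) ≡ crossL (toList L) (toList R)
  toList-join-cross L R with Vec-≡-dec _≟ᵇ_ L R
  ... | yes refl rewrite dec-true (List-≡-dec _≟ᵇ_ (toList L) (toList L)) refl =
    trans (toList-join _ _) (trans (cong₂ _++_ (toList-map not L) (toList-map not L))
      (cong (map not (toList L) ++_) (sym (++-identityʳ _))))
  ... | no L≢R
    rewrite dec-false (List-≡-dec _≟ᵇ_ (toList L) (toList R)) (λ eq → L≢R (toList-injective′ L R eq)) =
    trans (toList-join _ _) (cong (toList R ++_) (sym (++-identityʳ _)))

  toList-split : ∀ v → toList v ≡ toList (proj₁ (split v)) ++ toList (proj₂ (split v))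
  toList-split v = trans (cong toList (sym (join∘split v))) (toList-join _ _)

  join-adj : ∀ {p q} → Link p q → Adj (suc (suc e)) (join p) (join q)
  join-adj {L , R} {L′ , .R} (inj₁ (refl , a)) =
    subst₂ (AdjL (suc (suc e))) (sym (toList-join L R)) (sym (toList-join L′ R))
      (Halves.adj-inside {R = toList R} (length-toList L) a)
  join-adj {L , R} (inj₂ refl) =
    subst₂ (AdjL (suc (suc e))) (sym (toList-join L R)) (sym (toList-join-cross L R))
      (Halves.adj-across {L = toList L} {toList R} (length-toList L) (length-toList R))

  split-adj : ∀ {u v} → Adj (suc (suc e)) u v → Link (split u) (split v)
  split-adj {u} {v} a
    with Halves.adj-halves {L = toList L} {toList R} (length-toList L) (length-toList R)
           (subst (λ l → AdjL (suc (suc e)) l (toList v)) (toList-split u) a)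
    where
    L = proj₁ (split u)
    R = proj₂ (split u)
  ... | inj₁ (L′ , v≡ , a′)
    with ++-injective-length (trans (length-toList (proj₂ (split v))) (sym (length-toList (proj₂ (split u)))))
           (trans (sym (toList-split v)) v≡)
  ...   | Lv≡L′ , Rv≡R =
    inj₁ (sym (toList-injective′ (proj₂ (split v)) (proj₂ (split u)) Rv≡R) ,
          subst (AdjL (suc e) (toList (proj₁ (split u)))) (sym Lv≡L′) a′)
  split-adj {u} {v} a | inj₂ v≡cross =
    inj₂ (trans (cong split (toList-injective′ v _ (trans v≡cross (sym (toList-join-cross L R))))) (split∘join _))
    where
    L = proj₁ (split u)
    R = proj₂ (split u)

  FaultTolerant-double : ∀ g → FaultTolerant Link g → FaultTolerant (Adj (suc (suc e))) g
  FaultTolerant-double = FaultTolerant-transport (Adj (suc (suc e))) Link split join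
    join∘split split∘join split-adj join-adj

-- FDSC on 4 bits, by certified exhaustive search

module FDSC₂ where

  W₂ : Set
  W₂ = Vertex 2

  _≟_ : (x y : W₂) → Dec (x ≡ y)
  _≟_ = Vec-≡-dec _≟ᵇ_

  _∈?_ : (x : W₂) (xs : List W₂) → Dec (x ∈ xs)
  _∈?_ = ∈-dec _≟_

  vecs : ∀ n → List (Vec Bool n)
  vecs zero = [] ∷ []
  vecs (suc n) = map (false ∷_) (vecs n) ++ map (true ∷_) (vecs n)

  ∈-vecs : ∀ {n} (v : Vec Bool n) → v ∈ vecs n
  ∈-vecs [] = here refl
  ∈-vecs (false ∷ v) = ∈-++⁺ˡ (∈-map⁺ (false ∷_) (∈-vecs v))
  ∈-vecs (true ∷ v) = ∈-++⁺ʳ _ (∈-map⁺ (true ∷_) (∈-vecs v))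

  everywhere : ∀ {P : W₂ → Set} (P? : Decidable P) → {True (all? P? (vecs 4))} → ∀ v → P v
  everywhere P? {ok} v = All.lookup (toWitness ok) (∈-vecs v)

  flip₁ flip₂ flip₁₂ swapHalves : W₂ → W₂
  flip₁ (a ∷ b ∷ c ∷ d ∷ []) = not a ∷ b ∷ c ∷ d ∷ []
  flip₂ (a ∷ b ∷ c ∷ d ∷ []) = a ∷ not b ∷ c ∷ d ∷ []
  flip₁₂ (a ∷ b ∷ c ∷ d ∷ []) = not a ∷ not b ∷ c ∷ d ∷ []
  swapHalves (a ∷ b ∷ c ∷ d ∷ []) =
    if does (a ≟ᵇ c) ∧ does (b ≟ᵇ d)
      then not a ∷ not b ∷ not c ∷ not d ∷ []
      else c ∷ d ∷ a ∷ b ∷ []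

  neighbours : W₂ → List W₂
  neighbours v = flip₁ v ∷ swapHalves v ∷ flip₁₂ v ∷ flip₂ v ∷ []

  toList-flip₁ : ∀ v → toList (flip₁ v) ≡ flipFirst (toList v)
  toList-flip₁ (a ∷ b ∷ c ∷ d ∷ []) = refl

  toList-flip₂ : ∀ v → toList (flip₂ v) ≡ flipSecond (toList v)
  toList-flip₂ (a ∷ b ∷ c ∷ d ∷ []) = refl

  toList-swapHalves : ∀ v → toList (swapHalves v) ≡ divSwap 2 1 (toList v)
  toList-swapHalves = everywhere (λ v → List-≡-dec _≟ᵇ_ (toList (swapHalves v)) (divSwap 2 1 (toList v)))

  toList-flip₁₂ : ∀ v → toList (flip₁₂ v) ≡ divSwap 2 2 (toList v)
  toList-flip₁₂ = everywhere (λ v → List-≡-dec _≟ᵇ_ (toList (flip₁₂ v)) (divSwap 2 2 (toList v)))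

  Adj-neighbours : ∀ {v w} → w ∈ neighbours v → Adj 2 v w
  Adj-neighbours {v} (here refl) = inj₁ (toList-flip₁ v)
  Adj-neighbours {v} (there (here refl)) = inj₂ (inj₁ (1 , s≤s z≤n , s≤s z≤n , toList-swapHalves v))
  Adj-neighbours {v} (there (there (here refl))) = inj₂ (inj₁ (2 , s≤s z≤n , s≤s (s≤s z≤n) , toList-flip₁₂ v))
  Adj-neighbours {v} (there (there (there (here refl)))) = inj₂ (inj₂ (toList-flip₂ v))

  neighbours-Adj : ∀ {v w} → Adj 2 v w → w ∈ neighbours v
  neighbours-Adj {v} {w} (inj₁ eq) = here (toList-injective′ w (flip₁ v) (trans eq (sym (toList-flip₁ v))))
  neighbours-Adj {v} {w} (inj₂ (inj₁ (1 , _ , _ , eq))) =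
    there (here (toList-injective′ w (swapHalves v) (trans eq (sym (toList-swapHalves v)))))
  neighbours-Adj {v} {w} (inj₂ (inj₁ (2 , _ , _ , eq))) =
    there (there (here (toList-injective′ w (flip₁₂ v) (trans eq (sym (toList-flip₁₂ v))))))
  neighbours-Adj (inj₂ (inj₁ (suc (suc (suc _)) , _ , s≤s (s≤s ()) , _)))
  neighbours-Adj {v} {w} (inj₂ (inj₂ eq)) =
    there (there (there (here (toList-injective′ w (flip₂ v) (trans eq (sym (toList-flip₂ v)))))))

  Adj-sym : ∀ {v w} → Adj 2 v w → Adj 2 w v
  Adj-sym {v} a = Adj-neighbours (All.lookup (neighbours-symmetric v) (neighbours-Adj a))
    where
    neighbours-symmetric : ∀ v → All (λ w → v ∈ neighbours w) (neighbours v)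
    neighbours-symmetric = everywhere (λ v → all? (λ w → v ∈? neighbours w) (neighbours v))

  Faults : Set
  Faults = List (W₂ × W₂)

  Reachable : Faults → W₂ → W₂ → Set
  Reachable F r x = ¬ Faulty F x × Path (Adj 2) F r x

  accept? : ∀ F R w p → Dec (p ∈ R × w ∈ neighbours p × ¬ Faulty F w)
  accept? F R w p = p ∈? R ×-dec w ∈? neighbours p ×-dec ¬? (faulty? _≟_ F w)

  -- Accept a claimed tree edge (w , p) only after checking it; the claims come from an unverified search.
  extend : Faults → List W₂ → List (W₂ × W₂) → List W₂
  extend F R [] = R
  extend F R ((w , p) ∷ es) = if isYes (accept? F R w p) then extend F (w ∷ R) es else extend F R es

  All-if : ∀ {P : W₂ → Set} b {xs ys} → (T b → All P xs) → All P ys → All P (if b then xs else ys)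
  All-if true all-xs _ = all-xs _
  All-if false _ all-ys = all-ys

  extend-sound : ∀ F {r} R es → All (Reachable F r) R → All (Reachable F r) (extend F R es)
  extend-sound F R [] reached = reached
  extend-sound F R ((w , p) ∷ es) reached =
    All-if (isYes (accept? F R w p))
      (λ ok → extend-sound F (w ∷ R) es (new (toWitness {a? = accept? F R w p} ok) ∷ reached))
      (extend-sound F R es reached)
    where
    new : p ∈ R × w ∈ neighbours p × ¬ Faulty F w → Reachable F _ w
    new (p∈R , w∈ , w-live) =
      let p-live , to-p = All.lookup reached p∈R
      in w-live , to-p ◅◅ ((Adj-neighbours w∈ , p-live , w-live) ◅ ε)

  fresh : Faults → List W₂ → W₂ → List W₂
  fresh F seen x = filter (λ w → ¬? (faulty? _≟_ F w ⊎-dec w ∈? seen)) (neighbours x)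

  -- Breadth-first search returning tree edges (child , parent). `fresh` is passed as an argument so
  -- that the evaluator shares it instead of recomputing it at each use.
  search : ℕ → Faults → List W₂ → List W₂ → List (W₂ × W₂)
  searchFrom : ℕ → Faults → List W₂ → List W₂ → W₂ → List W₂ → List (W₂ × W₂)
  search zero _ _ _ = []
  search (suc _) _ _ [] = []
  search (suc n) F seen (x ∷ frontier) = searchFrom n F seen frontier x (fresh F seen x)
  searchFrom n F seen frontier x new = map (_, x) new ++ search n F (new ++ seen) (frontier ++ new)

  reach : Faults → W₂ → List W₂
  reach F r = extend F (r ∷ []) (search 16 F (r ∷ []) (r ∷ []))

  reach-sound : ∀ F {r} → ¬ Faulty F r → All (Reachable F r) (reach F r)
  reach-sound F {r} r-live = extend-sound F (r ∷ []) (search 16 F (r ∷ []) (r ∷ [])) ((r-live , ε) ∷ [])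

  reversePath : ∀ {F x y} → Path (Adj 2) F x y → Path (Adj 2) F y x
  reversePath = reverseStar λ (a , x-live , y-live) → Adj-sym a , y-live , x-live

  live : Faults → List W₂
  live F = filter (¬? ∘ faulty? _≟_ F) (vecs 4)

  ∈-live : ∀ {F x} → ¬ Faulty F x → x ∈ live F
  ∈-live {F} {x} x-live = ∈-filter⁺ (¬? ∘ faulty? _≟_ F) (∈-vecs x) x-live

  coveredBy : List W₂ → List W₂ → Bool
  coveredBy S xs = isYes (all? (_∈? S) xs)

  rootedAt : Faults → List W₂ → Bool
  rootedAt F [] = true
  rootedAt F (r ∷ rs) = coveredBy (reach F r) (r ∷ rs)

  connected? : Faults → Bool
  connected? F = rootedAt F (live F)

  connected-sound : ∀ F → connected? F ≡ true → ConnectedAfter (Adj 2) F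
  connected-sound F ok = go (live F) (all-filter (¬? ∘ faulty? _≟_ F) (vecs 4)) ∈-live (Equivalence.from T-≡ ok)
    where
    go : ∀ xs → All (¬_ ∘ Faulty F) xs → (∀ {x} → ¬ Faulty F x → x ∈ xs) → T (rootedAt F xs) →
      ConnectedAfter (Adj 2) F
    go [] _ complete _ x-live _ with complete x-live
    ... | ()
    go (r ∷ rs) (r-live ∷ _) complete ok x-live x′-live =
      reversePath (from-root x-live) ◅◅ from-root x′-live
      where
      from-root : ∀ {x} → ¬ Faulty F x → Path (Adj 2) F r x
      from-root x-live =
        proj₂ (All.lookup (reach-sound F r-live)
          (All.lookup (toWitness {a? = all? (_∈? reach F r) (r ∷ rs)} ok) (complete x-live)))

  Far : W₂ → W₂ → Set
  Far x w = w ≢ x × w ≢ comp x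

  far? : ∀ x w → Dec (Far x w)
  far? x w = ¬? (w ≟ x) ×-dec ¬? (w ≟ comp x)

  farLive? : ∀ F x w → Dec (Far x w × ¬ Faulty F w)
  farLive? F x w = far? x w ×-dec ¬? (faulty? _≟_ F w)

  largeAt? : ∀ F x →
    Dec (Faulty F x ⊎ Any (λ w → Far x w × ¬ Faulty F w) (neighbours x) ⊎ Any (Far x) (reach F x))
  largeAt? F x = faulty? _≟_ F x ⊎-dec any? (farLive? F x) (neighbours x) ⊎-dec any? (far? x) (reach F x)

  large? : Faults → Bool
  large? F = isYes (all? (largeAt? F) (vecs 4))

  large-sound : ∀ F → large? F ≡ true → ∀ x → ¬ Faulty F x →
    ∃[ w ] ¬ Faulty F w × w ≢ x × w ≢ comp x × Path (Adj 2) F x w × Path (Adj 2) F w x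
  large-sound F ok x x-live =
    witness (All.lookup (toWitness {a? = all? (largeAt? F) (vecs 4)} (Equivalence.from T-≡ ok)) (∈-vecs x))
    where
    witness : Faulty F x ⊎ Any (λ w → Far x w × ¬ Faulty F w) (neighbours x) ⊎ Any (Far x) (reach F x) →
      ∃[ w ] ¬ Faulty F w × w ≢ x × w ≢ comp x × Path (Adj 2) F x w × Path (Adj 2) F w x
    witness (inj₁ x-faulty) = ⊥-elim (x-live x-faulty)
    witness (inj₂ (inj₁ some)) =
      let w , w∈ , (w≢x , w≢comp) , w-live = find some
          path = (Adj-neighbours w∈ , x-live , w-live) ◅ ε
      in w , w-live , w≢x , w≢comp , path , reversePath path
    witness (inj₂ (inj₂ some)) =
      let w , w∈ , w≢x , w≢comp = find some
          w-live , path = All.lookup (reach-sound F x-live) w∈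
      in w , w-live , w≢x , w≢comp , path , reversePath path

  itemsAt edgesAt : W₂ → List (W₂ × W₂)
  itemsAt p = map (p ,_) (p ∷ neighbours p)
  edgesAt p = map (p ,_) (neighbours p)

  items edges : List (W₂ × W₂)
  items = concatMap itemsAt (vecs 4)
  edges = concatMap edgesAt (vecs 4)

  ∈-concatMap-at : ∀ {B : Set} (f : W₂ → List B) {x p} → x ∈ f p → x ∈ concatMap f (vecs 4)
  ∈-concatMap-at f {p = p} x∈ = ∈-concatMap⁺ f (Any.map (λ { refl → x∈ }) (∈-vecs p))

  ∈-items : ∀ {q} → IsFault (Adj 2) q → q ∈ items
  ∈-items (inj₁ refl) = ∈-concatMap-at itemsAt (here refl)
  ∈-items {p , _} (inj₂ a) = ∈-concatMap-at itemsAt (there (∈-map⁺ (p ,_) (neighbours-Adj a)))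

  ∈-edges : ∀ {q} → IsFault (Adj 2) q → NonDiagonal q → q ∈ edges
  ∈-edges (inj₁ diagonal) nd = ⊥-elim (nd diagonal)
  ∈-edges {p , _} (inj₂ a) _ = ∈-concatMap-at edgesAt (∈-map⁺ (p ,_) (neighbours-Adj a))

  checked : ∀ {A : Set} (p : A → Bool) xs → all p xs ≡ true → ∀ {x} → x ∈ xs → p x ≡ true
  checked p xs ok x∈ = Equivalence.to T-≡ (All.lookup (all⁺ p xs (Equivalence.from T-≡ ok)) x∈)

  vertexPlusFault-checked : all (λ y → all (λ q → connected? ((y , y) ∷ q ∷ [])) items) (vecs 4) ≡ true
  vertexPlusFault-checked = refl

  largeComponents-checked : all (λ p → all (λ q → large? (p ∷ q ∷ [])) edges) edges ≡ true
  largeComponents-checked = refl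

  -- The row index is explicit: inferring it would make Agda unfold the checks symbolically.
  vertexPlusFault-row : ∀ y → y ∈ vecs 4 → all (λ q → connected? ((y , y) ∷ q ∷ [])) items ≡ true
  vertexPlusFault-row y =
    checked (λ y → all (λ q → connected? ((y , y) ∷ q ∷ [])) items) (vecs 4) vertexPlusFault-checked

  vertexPlusFault : ∀ y q → IsFault (Adj 2) q → ConnectedAfter (Adj 2) ((y , y) ∷ q ∷ [])
  vertexPlusFault y q q-ok = connected-sound ((y , y) ∷ q ∷ [])
    (checked (λ q → connected? ((y , y) ∷ q ∷ [])) items (vertexPlusFault-row y (∈-vecs y)) (∈-items q-ok))

  largeComponents-row : ∀ p → p ∈ edges → all (λ q → large? (p ∷ q ∷ [])) edges ≡ true
  largeComponents-row p = checked (λ p → all (λ q → large? (p ∷ q ∷ [])) edges) edges largeComponents-checked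

  largeComponents : ∀ p q → IsFault (Adj 2) p → IsFault (Adj 2) q → NonDiagonal p → NonDiagonal q →
    ∀ x → ¬ Faulty (p ∷ q ∷ []) x →
    ∃[ w ] ¬ Faulty (p ∷ q ∷ []) w × w ≢ x × w ≢ comp x ×
      Path (Adj 2) (p ∷ q ∷ []) x w × Path (Adj 2) (p ∷ q ∷ []) w x
  largeComponents p q p-ok q-ok p-edge q-edge = large-sound (p ∷ q ∷ [])
    (checked (λ q → large? (p ∷ q ∷ [])) edges
      (largeComponents-row p (∈-edges p-ok p-edge)) (∈-edges q-ok q-edge))


FDSC-faultTolerant : ∀ e → FaultTolerant (Adj (3 + e)) (3 + e)
FDSC-faultTolerant zero =
  Base.FaultTolerant-double 3
    (Base.BaseCase.tolerant-three FDSC₂.vertexPlusFault FDSC₂.largeComponents (Vertex-moreThan 0))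
  where module Base = Doubling 1
FDSC-faultTolerant (suc e) =
  Step.FaultTolerant-double (4 + e) (Step.tolerant-step (s≤s z≤n) (FDSC-faultTolerant e) (Vertex-moreThan (suc e)))
  where module Step = Doubling (2 + e)

module _ {d : ℕ} (A1 : List (Vertex d)) (A2 : List (Edge d)) where

  removalFaults : List (Vertex d × Vertex d)
  removalFaults = map (λ w → w , w) A1 ++ map proj₁ A2

  removalFaults-isFault : All (IsFault (Adj d)) removalFaults
  removalFaults-isFault = ++⁺ (All-map⁺ (All.universal (λ _ → inj₁ refl) A1))
                              (All-map⁺ (All.universal (λ e → inj₂ (proj₂ e)) A2))

  length-removalFaults : length removalFaults ≡ length A1 + length A2
  length-removalFaults = trans (length-++ (map (λ w → w , w) A1)) (cong₂ _+_ (length-map _ A1) (length-map _ A2))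

  faulty⇒removed : ∀ {w} → Faulty removalFaults w → Removed d A1 A2 w
  faulty⇒removed f with ++⁻ (map (λ w → w , w) A1) f
  ... | inj₁ in-A1 = inj₁ (Any.map reduce (map⁻ in-A1))
  ... | inj₂ in-A2 = inj₂ (map⁻ in-A2)

  removed⇒faulty : ∀ {w} → Removed d A1 A2 w → Faulty removalFaults w
  removed⇒faulty (inj₁ w∈A1) = ++⁺ˡ (map⁺ (Any.map inj₁ w∈A1))
  removed⇒faulty (inj₂ hits) = ++⁺ʳ (map (λ w → w , w) A1) (map⁺ hits)

connectedAfterRemoval : ∀ d → FaultTolerant (Adj d) d → ∀ A1 A2 → length A1 + length A2 ≤ d →
  ConnectedAfterRemoval d A1 A2
connectedAfterRemoval d tolerant A1 A2 small u v u-live v-live =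
  gmap (λ w → w) (λ (a , x-live , y-live) → a , x-live ∘ removed⇒faulty A1 A2 , y-live ∘ removed⇒faulty A1 A2)
    (tolerant (removalFaults A1 A2) (removalFaults-isFault A1 A2)
      (subst (_≤ d) (sym (length-removalFaults A1 A2)) small)
      (u-live ∘ faulty⇒removed A1 A2) (v-live ∘ faulty⇒removed A1 A2))

mainTheorem4 : (d : ℕ) → 3 ≤ d →
    (A1 : List (Vertex d)) → (A2 : List (Edge d)) →
    length A1 + length A2 ≤ d →
    ConnectedAfterRemoval d A1 A2
mainTheorem4 (suc (suc (suc e))) (s≤s (s≤s (s≤s z≤n))) = connectedAfterRemoval (3 + e) (FDSC-faultTolerant e)
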